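{- Let $G$ be a graph with $|V_G|=n$ and let $M_1,\dots,M_n,N_1,\dots,N_n$ be graphs such that for every $i\in\{1,\dots,n\}$, $M_i=\emptyset$ implies $N_i=\emptyset$. Then there is a derivation in $\mathsf{SGS}{\downarrow}$ from $(M_1\sqcup N_1)\otimes\cdots\otimes(M_n\sqcup N_n)$ to $G\langle M_1,\dots,M_n\rangle\sqcup\overline G\langle N_1,\dots,N_n\rangle$, and there is a derivation in $\mathsf{SGS}{\uparrow}$ from $G\langle M_1,\dots,M_n\rangle\otimes\overline G\langle N_1,\dots,N_n\rangle$ to $(M_1\otimes N_1)\sqcup\cdots\sqcup(M_n\otimes N_n)$.
   Context: Atoms: a countable set $\mathcal V$ of variables and a disjoint copy $\overline{\mathcal V}$; atoms are elements of $\mathcal V\cup\overline{\mathcal V}$, with $\overline{\overline a}=a$. A graph is a finite simple undirected graph with vertices labelled by atoms, identified up to label-preserving isomorphism; $\emptyset$ is the empty graph; $a$ also denotes a one-vertex graph. $G\sqcup H$ is disjoint union; $G\otimes H$ is disjoint union plus all edges between $V_G$ and $V_H$. $\overline G$: same vertices, complementary edges ($vw$ with $v\neq w$), dual labels. A context is a graph $C$ with $R\subseteq V_C$; $C[M]_R$ is $C\sqcup M$ plus all edges between $V_M$ and $R$. A module of $G$ is an induced subgraph $M$ with every outside vertex adjacent to all or none of $M$; $P$ is prime if $|V_P|\ge2$ and its only modules are $\emptyset$, singletons and $P$. For $G$ with vertices $v_1,\dots,v_n$, $G\langle H_1,\dots,H_n\rangle$ replaces $v_i$ by $H_i$, keeps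 internal edges, joins $H_i$ to $H_j$ ($i\ne j$) iff $v_iv_j\in E_G$; $\overline G\langle H_1,\dots,H_n\rangle$ is defined with the same vertex order $v_1,\dots,v_n$. Rules (premise $\longrightarrow$ conclusion): $\mathsf{ai}{\downarrow}$: $\emptyset\longrightarrow\overline a\sqcup a$; $\mathsf{ss}{\downarrow}$: $B[A]_S\longrightarrow B\sqcup A$, $S\subseteq V_B$, $S\ne\emptyset$, $A\ne\emptyset$; $\mathsf{p}{\downarrow}$: $(M_1\sqcup N_1)\otimes\cdots\otimes(M_n\sqcup N_n)\longrightarrow\overline P\langle M_1,\dots,M_n\rangle\sqcup P\langle N_1,\dots,N_n\rangle$, $P$ prime, $n=|V_P|\ge4$, all $M_i\ne\emptyset$; $\mathsf{ai}{\uparrow}$: $a\otimes\overline a\longrightarrow\emptyset$; $\mathsf{ss}{\uparrow}$: $B\otimes A\longrightarrow B[A]_S$, $S\subseteq V_B$, $S\ne V_B$, $A\ne\emptyset$; $\mathsf{p}{\uparrow}$: $P\langle M_1,\dots,M_n\rangle\otimes\overline P\langle N_1,\dots,N_n\rangle\longrightarrow(M_1\otimes N_1)\sqcup\cdots\sqcup(M_n\otimes N_n)$, $P$ prime, $n=|V_P|\ge4$, all $M_i\ne\emptyset$. $\mathsf{SGS}{\downarrow}=\{\mathsf{ai}{\downarrow},\mathsf{ss}{\downarrow},\mathsf{p}{\downarrow}\}$ and $\mathsf{SGS}{\uparrow}=\{\mathsf{ai}{\uparrow},\mathsf{ss}{\uparrow},\mathsf{p}{\uparrow}\}$. A derivation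 in a system $\mathsf S$ from $X$ to $Y$ is a finite sequence of graphs from $X$ to $Y$ each step of which is a label-preserving isomorphism or replaces $C[X']_R$ by $C[Y']_R$ for a context and an instance $X'\longrightarrow Y'$ of a rule of $\mathsf S$. -}

module Defs where

open import Data.Nat using (ℕ)
open import Data.Bool using (Bool; true; false; not; _∧_; _∨_)
open import Data.Empty using (⊥)
open import Data.Unit using (⊤; tt)
open import Data.Fin using (Fin)
open import Data.Sum using (_⊎_; inj₁; inj₂)
open import Data.Product using (Σ; Σ-syntax; _×_; _,_)
open import Data.List using (List; []; _∷_; map; _++_; concatMap)
open import Data.List.Relation.Unary.Any using (Any; here; there)
open import Data.List.Membership.Propositional using (_∈_)
open import Data.List.Membership.Propositional.Properties
  using (∈-map⁺; ∈-++⁺ˡ; ∈-++⁺ʳ; ∈-concatMap⁺)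
open import Data.List.Membership.Propositional.Properties using ()
open import Data.List.Relation.Unary.Any.Properties using ()
import Data.Sum.Properties as SumP
import Data.Product.Properties as ProdP
open import Relation.Nullary using (¬_; Dec; yes; no)
open import Relation.Nullary.Decidable using (⌊_⌋)
open import Relation.Binary.PropositionalEquality using (_≡_; refl)
open import Relation.Binary.Definitions using (DecidableEquality)
open import Relation.Binary.Construct.Closure.ReflexiveTransitive using (Star)
open import Function.Bundles using (_↔_; Inverse)
open import Function.Definitions using (Injective)

data Atom : Set where
  var  : ℕ → Atom
  dvar : ℕ → Atom

dualA : Atom → Atom
dualA (var x)  = dvar x
dualA (dvar x) = var x

-- The vertex set V is a finite type (decidable equality + a covering list).
-- 'adj' is a raw Bool relation; the actual (simple, undirected) edge relation
-- is its irreflexive symmetric closure 'E' below.  All constructions and the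
-- notion of isomorphism only look at 'E', so graphs are finite simple
-- undirected graphs.

record Graph : Set₁ where
  field
    V        : Set
    _≟V_     : DecidableEquality V
    elems    : List V
    complete : ∀ v → v ∈ elems
    label    : V → Atom
    adj      : V → V → Bool

open Graph public

E : (G : Graph) → V G → V G → Bool
E G v w = not ⌊ _≟V_ G v w ⌋ ∧ (adj G v w ∨ adj G w v)

record _≅_ (G H : Graph) : Set where
  field
    bij      : V G ↔ V H
    labelPres : ∀ v → label H (Inverse.to bij v) ≡ label G v
    edgePres  : ∀ v w → E H (Inverse.to bij v) (Inverse.to bij w) ≡ E G v w

∅G : Graph
∅G = record
  { V = ⊥ ; _≟V_ = λ () ; elems = [] ; complete = λ ()
  ; label = λ () ; adj = λ () }

atomG : Atom → Graph
atomG a = record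
  { V = ⊤ ; _≟V_ = λ { tt tt → yes refl } ; elems = tt ∷ [] ; complete = λ { tt → here refl }
  ; label = λ _ → a ; adj = λ _ _ → false }

joinG : (G H : Graph) → (V G → Bool) → Graph
joinG G H cross = record
  { V = V G ⊎ V H
  ; _≟V_ = SumP.≡-dec (_≟V_ G) (_≟V_ H)
  ; elems = map inj₁ (elems G) ++ map inj₂ (elems H)
  ; complete = λ { (inj₁ v) → ∈-++⁺ˡ (∈-map⁺ inj₁ (complete G v))
                 ; (inj₂ w) → ∈-++⁺ʳ (map inj₁ (elems G)) (∈-map⁺ inj₂ (complete H w)) }
  ; label = λ { (inj₁ v) → label G v ; (inj₂ w) → label H w }
  ; adj = λ { (inj₁ v) (inj₁ v′) → E G v v′
            ; (inj₂ w) (inj₂ w′) → E H w w′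
            ; (inj₁ v) (inj₂ w)  → cross v
            ; (inj₂ w) (inj₁ v)  → cross v } }

_⊔G_ : Graph → Graph → Graph
G ⊔G H = joinG G H (λ _ → false)

_⊗G_ : Graph → Graph → Graph
G ⊗G H = joinG G H (λ _ → true)

-- C[M]_R for a context (C, R) with R ⊆ V_C given as a Bool predicate
plug : (C : Graph) → (V C → Bool) → Graph → Graph
plug C R M = joinG C M R

compl : Graph → Graph
compl G = record
  { V = V G ; _≟V_ = _≟V_ G ; elems = elems G ; complete = complete G
  ; label = λ v → dualA (label G v) ; adj = λ v w → not (E G v w) }

-- substitution G⟨H_v⟩_{v ∈ V_G} (indexed by the vertices of G)
private
  substAdj : (G : Graph) (H : V G → Graph) (v w : V G) → Dec (v ≡ w) →
             V (H v) → V (H w) → Bool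
  substAdj G H v .v (yes refl) x y = E (H v) x y
  substAdj G H v w  (no _)     x y = E G v w

  Σelems : (G : Graph) (H : V G → Graph) → List (Σ (V G) (λ v → V (H v)))
  Σelems G H = concatMap (λ v → map (v ,_) (elems (H v))) (elems G)

  anyAt : (G : Graph) (H : V G → Graph) (v : V G) (x : V (H v)) (us : List (V G)) →
          v ∈ us → Any (λ u → (v , x) ∈ map (u ,_) (elems (H u))) us
  anyAt G H v x (.v ∷ us) (here refl) = here (∈-map⁺ (v ,_) (complete (H v) x))
  anyAt G H v x (u ∷ us) (there p) = there (anyAt G H v x us p)

  Σcomplete : (G : Graph) (H : V G → Graph) → ∀ p → p ∈ Σelems G H
  Σcomplete G H (v , x) = ∈-concatMap⁺ (λ u → map (u ,_) (elems (H u))) (anyAt G H v x (elems G) (complete G v))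

substG : (G : Graph) → (V G → Graph) → Graph
substG G H = record
  { V = Σ (V G) (λ v → V (H v))
  ; _≟V_ = ProdP.≡-dec (_≟V_ G) (λ {v} → _≟V_ (H v))
  ; elems = Σelems G H
  ; complete = Σcomplete G H
  ; label = λ { (v , x) → label (H v) x }
  ; adj = λ { (v , x) (w , y) → substAdj G H v w (_≟V_ G v w) x y } }

completeOn edgelessOn : Graph → Graph
completeOn I = record I { adj = λ _ _ → true }
edgelessOn I = record I { adj = λ _ _ → false }

-- n-ary ⊗ and ⊔ of a family indexed by the vertices of I
-- (H_{v_1} ⊗ ⋯ ⊗ H_{v_n}, resp. H_{v_1} ⊔ ⋯ ⊔ H_{v_n})
⨂ : (I : Graph) → (V I → Graph) → Graph
⨂ I H = substG (completeOn I) H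

⨆ : (I : Graph) → (V I → Graph) → Graph
⨆ I H = substG (edgelessOn I) H

IsEmptyG : Graph → Set
IsEmptyG G = ¬ V G

NonEmptyG : Graph → Set
NonEmptyG G = V G

AtLeast : ℕ → Graph → Set
AtLeast k G = Σ (Fin k → V G) (λ f → Injective _≡_ _≡_ f)

IsModule : (G : Graph) → (V G → Bool) → Set
IsModule G S = ∀ x → S x ≡ false →
  (∀ y → S y ≡ true → E G x y ≡ true) ⊎ (∀ y → S y ≡ true → E G x y ≡ false)

Prime : Graph → Set
Prime P = AtLeast 2 P ×
  (∀ S → IsModule P S →
     (∀ v → S v ≡ false)
     ⊎ (Σ[ v ∈ V P ] (S v ≡ true × (∀ w → S w ≡ true → w ≡ v)))
     ⊎ (∀ v → S v ≡ true))

data SGS↓ : Graph → Graph → Set₁ where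
  ai↓ : (a : Atom) → SGS↓ ∅G (atomG (dualA a) ⊔G atomG a)
  ss↓ : (B A : Graph) (S : V B → Bool) →
        Σ[ v ∈ V B ] (S v ≡ true) → NonEmptyG A →
        SGS↓ (plug B S A) (B ⊔G A)
  p↓  : (P : Graph) → Prime P → AtLeast 4 P → (M N : V P → Graph) →
        (∀ v → NonEmptyG (M v)) →
        SGS↓ (⨂ P (λ v → M v ⊔G N v)) (substG (compl P) M ⊔G substG P N)

data SGS↑ : Graph → Graph → Set₁ where
  ai↑ : (a : Atom) → SGS↑ (atomG a ⊗G atomG (dualA a)) ∅G
  ss↑ : (B A : Graph) (S : V B → Bool) →
        Σ[ v ∈ V B ] (S v ≡ false) → NonEmptyG A →
        SGS↑ (B ⊗G A) (plug B S A)
  p↑  : (P : Graph) → Prime P → AtLeast 4 P → (M N : V P → Graph) →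
        (∀ v → NonEmptyG (M v)) →
        SGS↑ (substG P M ⊗G substG (compl P) N) (⨆ P (λ v → M v ⊗G N v))

data Step (R : Graph → Graph → Set₁) : Graph → Graph → Set₁ where
  isoStep  : ∀ {G H} → G ≅ H → Step R G H
  ruleStep : (C : Graph) (Rs : V C → Bool) {X Y : Graph} → R X Y →
             Step R (plug C Rs X) (plug C Rs Y)

Derivation : (Graph → Graph → Set₁) → Graph → Graph → Set₁
Derivation R = Star (Step R)

module Submission where

-- Delete the vertices v with M v empty (then N v is empty too) and induct on the number of vertices.
-- If G has a module S with at least two vertices and S ≠ V_G, contracting S to one vertex gives a smaller
-- graph Q with G⟨M⟩ ≅ Q⟨M_v (v ∉ S), G[S]⟨M⟩⟩; the same decomposition holds for the complement and for
-- the complete and edgeless graphs on V_G, so the derivation for G[S], placed in context, followed by the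
-- one for Q, is a derivation for G. Otherwise every module of G is trivial: G has at most two vertices
-- (every graph on three vertices has a nontrivial module), where one or two switches suffice, or G and its
-- complement are prime with at least four vertices, where the rules are instances of p↓ and p↑.

open import Defs
open import Data.Bool using (Bool; true; false; not; _∧_; _∨_; T; _≟_)
open import Data.Bool.Properties
  using (∨-comm; ∨-idem; not-involutive; not-injective; not-¬; ¬-not; T-irrelevant; T-≡; T-not-≡)
open import Data.Empty using (⊥; ⊥-elim)
open import Data.Fin using (inject≤)
import Data.Fin as Fin
open import Data.Fin.Properties using (inject≤-injective)
open import Data.List using (List; []; _∷_; length; map; _++_; filter; deduplicate)
import Data.List as List
open import Data.List.Properties using (length-++; length-map)
open import Data.List.Membership.Propositional using (_∈_; lose)
open import Data.List.Membership.Propositional.Properties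
  using (∈-++⁺ˡ; ∈-++⁺ʳ; ∈-map⁺; ∈-filter⁺; ∈-filter⁻; ∈-lookup; ∈-deduplicate⁺)
import Data.List.Membership.DecPropositional as DecMembership
open import Data.List.Relation.Unary.All using (all?; _∷_; [])
import Data.List.Relation.Unary.All as All
open import Data.List.Relation.Unary.AllPairs using (_∷_)
open import Data.List.Relation.Unary.Any using (here; there; any?; satisfied)
open import Data.List.Relation.Unary.Unique.Propositional using (Unique)
open import Data.List.Relation.Unary.Unique.DecPropositional.Properties using (deduplicate-!)
open import Data.Nat using (zero; suc; _+_; _≤_; _<_; z≤n; s≤s)
open import Data.Nat.Properties using (m≤n⇒m≤1+n; ≤-pred; ≤-refl; ≤-trans; +-comm)
open import Data.Product using (Σ; _×_; _,_; proj₁; proj₂)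
open import Data.Product.Properties using (Σ-≡,≡→≡)
open import Data.Sum using (_⊎_; inj₁; inj₂; [_,_])
import Data.Sum as Sum
open import Data.Sum.Properties using (swap-involutive; inj₁-injective; inj₂-injective)
open import Data.Unit using (⊤; tt)
open import Function using (id; const; _∘_; _∘′_; case_of_)
open import Function.Bundles using (Inverse; mk↔ₛ′; Equivalence)
open import Relation.Nullary using (¬_; Dec; yes; no; does)
open import Relation.Nullary.Decidable
  using (⌊_⌋; map′; ⌊⌋-map′; T?; ¬?; _×-dec_; _⊎-dec_; _→-dec_; toWitness; fromWitness; fromWitnessFalse)
open import Relation.Binary.PropositionalEquality hiding ([_])
open import Relation.Binary.Construct.Closure.ReflexiveTransitive using (ε; _◅_; _◅◅_)

module _ (G : Graph) where

  ∀? : {P : V G → Set} → (∀ v → Dec (P v)) → Dec (∀ v → P v)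
  ∀? P? = map′ (λ ps v → All.lookup ps (complete G v)) (λ ps → All.tabulate (λ {v} _ → ps v))
               (all? P? (elems G))

  ∃? : {P : V G → Set} → (∀ v → Dec (P v)) → Dec (Σ (V G) P)
  ∃? P? = map′ satisfied (λ (v , pv) → lose (complete G v) pv) (any? P? (elems G))

nonempty? : (G : Graph) → Dec (V G)
nonempty? G = map′ proj₁ (_, tt) (∃? G (λ _ → yes tt))

module _ (G : Graph) where

  E-sym : ∀ v w → E G v w ≡ E G w v
  E-sym v w with _≟V_ G v w | _≟V_ G w v
  ... | yes refl | yes _ = refl
  ... | yes v≡w  | no w≢v = ⊥-elim (w≢v (sym v≡w))
  ... | no v≢w   | yes w≡v = ⊥-elim (v≢w (sym w≡v))
  ... | no _     | no _ = ∨-comm (adj G v w) (adj G w v)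

  E-irrefl : ∀ v → E G v v ≡ false
  E-irrefl v with _≟V_ G v v
  ... | yes _ = refl
  ... | no v≢v = ⊥-elim (v≢v refl)

  E-distinct : ∀ v w → ¬ v ≡ w → E G v w ≡ (adj G v w ∨ adj G w v)
  E-distinct v w v≢w with _≟V_ G v w
  ... | yes v≡w = ⊥-elim (v≢w v≡w)
  ... | no _ = refl

  -- Joins and substitutions use E G itself as the raw adjacency of a copy of G.
  E-idempotent : ∀ v w {A : Set} (f : v ≡ w → A) (g : A → v ≡ w) →
                 not ⌊ map′ f g (_≟V_ G v w) ⌋ ∧ (E G v w ∨ E G w v) ≡ E G v w
  E-idempotent v w f g =
    trans (cong (λ b → not b ∧ (E G v w ∨ E G w v)) (⌊⌋-map′ f g (_≟V_ G v w)))
          (by-cases (_≟V_ G v w))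
    where
    by-cases : (d : Dec (v ≡ w)) → not ⌊ d ⌋ ∧ (E G v w ∨ E G w v) ≡ E G v w
    by-cases (yes refl) = sym (E-irrefl v)
    by-cases (no _) rewrite E-sym w v = ∨-idem (E G v w)

join-edge : (G H : Graph) → (V G → Bool) → V G ⊎ V H → V G ⊎ V H → Bool
join-edge G H c (inj₁ v) (inj₁ w) = E G v w
join-edge G H c (inj₁ v) (inj₂ _) = c v
join-edge G H c (inj₂ _) (inj₁ w) = c w
join-edge G H c (inj₂ v) (inj₂ w) = E H v w

E-join : (G H : Graph) (c : V G → Bool) → ∀ x y → E (joinG G H c) x y ≡ join-edge G H c x y
E-join G H c (inj₁ v) (inj₁ w) = E-idempotent G v w _ _
E-join G H c (inj₁ v) (inj₂ w) = ∨-idem (c v)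
E-join G H c (inj₂ v) (inj₁ w) = ∨-idem (c w)
E-join G H c (inj₂ v) (inj₂ w) = E-idempotent H v w _ _

E-subst-same : (G : Graph) (H : V G → Graph) → ∀ v x y → E (substG G H) (v , x) (v , y) ≡ E (H v) x y
E-subst-same G H v x y with _≟V_ G v v
... | yes refl = E-idempotent (H v) x y _ _
... | no v≢v = ⊥-elim (v≢v refl)

E-subst-distinct : (G : Graph) (H : V G → Graph) → ∀ {v w} x y → ¬ v ≡ w →
                   E (substG G H) (v , x) (w , y) ≡ E G v w
E-subst-distinct G H {v} {w} x y v≢w with _≟V_ G v w | _≟V_ G w v
... | yes v≡w | _ = ⊥-elim (v≢w v≡w)
... | no _ | yes w≡v = ⊥-elim (v≢w (sym w≡v))
... | no _ | no _ = begin
  E G v w ∨ E G w v  ≡⟨ cong (E G v w ∨_) (E-sym G w v) ⟩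
  E G v w ∨ E G v w  ≡⟨ ∨-idem (E G v w) ⟩
  E G v w            ≡⟨ E-distinct G v w v≢w ⟩
  adj G v w ∨ adj G w v ∎
  where open ≡-Reasoning

E-compl : (G : Graph) → ∀ v w → ¬ v ≡ w → E (compl G) v w ≡ not (E G v w)
E-compl G v w v≢w rewrite E-distinct (compl G) v w v≢w | E-sym G w v = ∨-idem (not (E G v w))

-- uniform true G and uniform false G are definitionally completeOn G and edgelessOn G.
uniform : Bool → Graph → Graph
uniform b G = record G { adj = λ _ _ → b }

E-uniform : (b : Bool) (G : Graph) → ∀ {v w} → ¬ v ≡ w → E (uniform b G) v w ≡ b
E-uniform b G {v} {w} v≢w = trans (E-distinct (uniform b G) v w v≢w) (∨-idem b)

mk≅ : {G H : Graph} (to : V G → V H) (from : V H → V G) →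
      (∀ y → to (from y) ≡ y) → (∀ x → from (to x) ≡ x) →
      (∀ v → label H (to v) ≡ label G v) →
      (∀ v w → E H (to v) (to w) ≡ E G v w) → G ≅ H
mk≅ to from to∘from from∘to labels edges =
  record { bij = mk↔ₛ′ to from to∘from from∘to ; labelPres = labels ; edgePres = edges }

≅-refl : {G : Graph} → G ≅ G
≅-refl = mk≅ id id (λ _ → refl) (λ _ → refl) (λ _ → refl) (λ _ _ → refl)

≅-sym : {G H : Graph} → G ≅ H → H ≅ G
≅-sym {G} {H} i = mk≅ I.from I.to I.strictlyInverseʳ I.strictlyInverseˡ
  (λ w → trans (sym (labelPres (I.from w))) (cong (label H) (I.strictlyInverseˡ w)))
  (λ v w → trans (sym (edgePres (I.from v) (I.from w)))
                 (cong₂ (E H) (I.strictlyInverseˡ v) (I.strictlyInverseˡ w)))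
  where
  open _≅_ i
  module I = Inverse bij

≅-trans : {G H K : Graph} → G ≅ H → H ≅ K → G ≅ K
≅-trans i j = mk≅ (J.to ∘′ I.to) (I.from ∘′ J.from)
  (λ z → trans (cong J.to (I.strictlyInverseˡ (J.from z))) (J.strictlyInverseˡ z))
  (λ x → trans (cong I.from (J.strictlyInverseʳ (I.to x))) (I.strictlyInverseʳ x))
  (λ v → trans (_≅_.labelPres j (I.to v)) (_≅_.labelPres i v))
  (λ v w → trans (_≅_.edgePres j (I.to v) (I.to w)) (_≅_.edgePres i v w))
  where
  module I = Inverse (_≅_.bij i)
  module J = Inverse (_≅_.bij j)

≅-empty : {G H : Graph} → ¬ V G → ¬ V H → G ≅ H
≅-empty ¬G ¬H =
  mk≅ (⊥-elim ∘ ¬G) (⊥-elim ∘ ¬H) (⊥-elim ∘ ¬H) (⊥-elim ∘ ¬G) (⊥-elim ∘ ¬G) (λ v → ⊥-elim (¬G v))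

join-cong : {G G′ H H′ : Graph} {c : V G → Bool} {c′ : V G′ → Bool} →
            (i : G ≅ G′) (j : H ≅ H′) → (∀ v → c′ (Inverse.to (_≅_.bij i) v) ≡ c v) →
            joinG G H c ≅ joinG G′ H′ c′
join-cong {G} {G′} {H} {H′} {c} {c′} i j c-pres = mk≅ to from to∘from from∘to labels edges
  where
  module I = Inverse (_≅_.bij i)
  module J = Inverse (_≅_.bij j)
  to : V G ⊎ V H → V G′ ⊎ V H′
  to = Sum.map I.to J.to
  from : V G′ ⊎ V H′ → V G ⊎ V H
  from = Sum.map I.from J.from
  to∘from : ∀ y → to (from y) ≡ y
  to∘from (inj₁ v) = cong inj₁ (I.strictlyInverseˡ v)
  to∘from (inj₂ v) = cong inj₂ (J.strictlyInverseˡ v)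
  from∘to : ∀ x → from (to x) ≡ x
  from∘to (inj₁ v) = cong inj₁ (I.strictlyInverseʳ v)
  from∘to (inj₂ v) = cong inj₂ (J.strictlyInverseʳ v)
  labels : ∀ v → label (joinG G′ H′ c′) (to v) ≡ label (joinG G H c) v
  labels (inj₁ v) = _≅_.labelPres i v
  labels (inj₂ v) = _≅_.labelPres j v
  join-edges : ∀ x y → join-edge G′ H′ c′ (to x) (to y) ≡ join-edge G H c x y
  join-edges (inj₁ v) (inj₁ w) = _≅_.edgePres i v w
  join-edges (inj₁ v) (inj₂ _) = c-pres v
  join-edges (inj₂ _) (inj₁ w) = c-pres w
  join-edges (inj₂ v) (inj₂ w) = _≅_.edgePres j v w
  edges : ∀ x y → E (joinG G′ H′ c′) (to x) (to y) ≡ E (joinG G H c) x y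
  edges x y = trans (E-join G′ H′ c′ (to x) (to y)) (trans (join-edges x y) (sym (E-join G H c x y)))

join-cross-cong : (G H : Graph) {c c′ : V G → Bool} → (∀ v → V H → c v ≡ c′ v) →
                  joinG G H c ≅ joinG G H c′
join-cross-cong G H {c} {c′} c≡c′ = mk≅ id id (λ _ → refl) (λ _ → refl) labels edges
  where
  labels : ∀ x → label (joinG G H c′) x ≡ label (joinG G H c) x
  labels (inj₁ _) = refl
  labels (inj₂ _) = refl
  join-edges : ∀ x y → join-edge G H c′ x y ≡ join-edge G H c x y
  join-edges (inj₁ v) (inj₁ w) = refl
  join-edges (inj₁ v) (inj₂ w) = sym (c≡c′ v w)
  join-edges (inj₂ v) (inj₁ w) = sym (c≡c′ w v)
  join-edges (inj₂ v) (inj₂ w) = refl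
  edges : ∀ x y → E (joinG G H c′) x y ≡ E (joinG G H c) x y
  edges x y = trans (E-join G H c′ x y) (trans (join-edges x y) (sym (E-join G H c x y)))

join-comm : (G H : Graph) (b : Bool) → joinG G H (const b) ≅ joinG H G (const b)
join-comm G H b = mk≅ Sum.swap Sum.swap swap-involutive swap-involutive labels edges
  where
  labels : ∀ x → label (joinG H G (const b)) (Sum.swap x) ≡ label (joinG G H (const b)) x
  labels (inj₁ _) = refl
  labels (inj₂ _) = refl
  join-edges : ∀ x y → join-edge H G (const b) (Sum.swap x) (Sum.swap y) ≡ join-edge G H (const b) x y
  join-edges (inj₁ _) (inj₁ _) = refl
  join-edges (inj₁ _) (inj₂ _) = refl
  join-edges (inj₂ _) (inj₁ _) = refl
  join-edges (inj₂ _) (inj₂ _) = refl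
  edges : ∀ x y → E (joinG H G (const b)) (Sum.swap x) (Sum.swap y) ≡ E (joinG G H (const b)) x y
  edges x y = trans (E-join H G (const b) (Sum.swap x) (Sum.swap y))
                    (trans (join-edges x y) (sym (E-join G H (const b) x y)))

plug-assoc : (C : Graph) (R : V C → Bool) (D : Graph) (S : V D → Bool) (X : Graph) →
             plug C R (plug D S X) ≅ plug (plug C R D) [ R , S ] X
plug-assoc C R D S X = mk≅ to from to∘from from∘to labels edges
  where
  CD = joinG C D R
  DX = joinG D X S
  to : V C ⊎ (V D ⊎ V X) → (V C ⊎ V D) ⊎ V X
  to = Sum.assocˡ
  from : (V C ⊎ V D) ⊎ V X → V C ⊎ (V D ⊎ V X)
  from = Sum.assocʳ
  to∘from : ∀ y → to (from y) ≡ y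
  to∘from (inj₁ (inj₁ _)) = refl
  to∘from (inj₁ (inj₂ _)) = refl
  to∘from (inj₂ _) = refl
  from∘to : ∀ y → from (to y) ≡ y
  from∘to (inj₁ _) = refl
  from∘to (inj₂ (inj₁ _)) = refl
  from∘to (inj₂ (inj₂ _)) = refl
  labels : ∀ v → label (joinG CD X [ R , S ]) (to v) ≡ label (joinG C DX R) v
  labels (inj₁ _) = refl
  labels (inj₂ (inj₁ _)) = refl
  labels (inj₂ (inj₂ _)) = refl
  join-edges : ∀ x y → join-edge CD X [ R , S ] (to x) (to y) ≡ join-edge C DX R x y
  join-edges (inj₁ a) (inj₁ b) = E-join C D R (inj₁ a) (inj₁ b)
  join-edges (inj₁ a) (inj₂ (inj₁ b)) = E-join C D R (inj₁ a) (inj₂ b)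
  join-edges (inj₁ _) (inj₂ (inj₂ _)) = refl
  join-edges (inj₂ (inj₁ a)) (inj₁ b) = E-join C D R (inj₂ a) (inj₁ b)
  join-edges (inj₂ (inj₁ a)) (inj₂ (inj₁ b)) =
    trans (E-join C D R (inj₂ a) (inj₂ b)) (sym (E-join D X S (inj₁ a) (inj₁ b)))
  join-edges (inj₂ (inj₁ a)) (inj₂ (inj₂ b)) = sym (E-join D X S (inj₁ a) (inj₂ b))
  join-edges (inj₂ (inj₂ _)) (inj₁ _) = refl
  join-edges (inj₂ (inj₂ a)) (inj₂ (inj₁ b)) = sym (E-join D X S (inj₂ a) (inj₁ b))
  join-edges (inj₂ (inj₂ a)) (inj₂ (inj₂ b)) = sym (E-join D X S (inj₂ a) (inj₂ b))
  edges : ∀ x y → E (joinG CD X [ R , S ]) (to x) (to y) ≡ E (joinG C DX R) x y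
  edges x y = trans (E-join CD X [ R , S ] (to x) (to y)) (trans (join-edges x y) (sym (E-join C DX R x y)))

plug-∅ : (R : V ∅G → Bool) (X : Graph) → plug ∅G R X ≅ X
plug-∅ R X = mk≅ to inj₂ (λ _ → refl) from∘to (λ { (inj₂ _) → refl }) edges
  where
  to : ⊥ ⊎ V X → V X
  to (inj₂ x) = x
  from∘to : ∀ y → inj₂ (to y) ≡ y
  from∘to (inj₂ _) = refl
  edges : ∀ x y → E X (to x) (to y) ≡ E (plug ∅G R X) x y
  edges (inj₂ a) (inj₂ b) = sym (E-join ∅G X R (inj₂ a) (inj₂ b))

join-assoc : (X Y Z : Graph) (b : Bool) →
             joinG X (joinG Y Z (const b)) (const b) ≅ joinG (joinG X Y (const b)) Z (const b)
join-assoc X Y Z b = ≅-trans (plug-assoc X (const b) Y (const b) Z)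
                             (join-cross-cong _ Z λ { (inj₁ _) _ → refl ; (inj₂ _) _ → refl })

-- Substitution
subst-edges : (G G′ : Graph) (H : V G → Graph) (H′ : V G′ → Graph)
  (f : V G → V G′) (t : ∀ v → V (H v) → V (H′ (f v))) →
  (∀ {v w} → ¬ v ≡ w → ¬ f v ≡ f w) →
  (∀ v w → ¬ v ≡ w → E G′ (f v) (f w) ≡ E G v w) →
  (∀ v x y → E (H′ (f v)) (t v x) (t v y) ≡ E (H v) x y) →
  ∀ p q → E (substG G′ H′) (f (proj₁ p) , t _ (proj₂ p)) (f (proj₁ q) , t _ (proj₂ q))
          ≡ E (substG G H) p q
subst-edges G G′ H H′ f t f-injective f-edges t-edges (v , x) (w , y) = by-cases (_≟V_ G v w)
  where
  by-cases : Dec (v ≡ w) → E (substG G′ H′) (f v , t v x) (f w , t w y) ≡ E (substG G H) (v , x) (w , y)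
  by-cases (yes refl) =
    trans (E-subst-same G′ H′ (f v) _ _) (trans (t-edges v x y) (sym (E-subst-same G H v x y)))
  by-cases (no v≢w) = trans (E-subst-distinct G′ H′ _ _ (f-injective v≢w))
                            (trans (f-edges v w v≢w) (sym (E-subst-distinct G H x y v≢w)))

subst-cong : (G : Graph) {H H′ : V G → Graph} → (∀ v → H v ≅ H′ v) → substG G H ≅ substG G H′
subst-cong G {H} {H′} i = mk≅ to from to∘from from∘to (λ (v , x) → _≅_.labelPres (i v) x)
  (subst-edges G G H H′ id (λ v → I.to v) id (λ _ _ _ → refl) (λ v → _≅_.edgePres (i v)))
  where
  module I v = Inverse (_≅_.bij (i v))
  to : V (substG G H) → V (substG G H′)
  to (v , x) = v , I.to v x
  from : V (substG G H′) → V (substG G H)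
  from (v , x) = v , I.from v x
  to∘from : ∀ y → to (from y) ≡ y
  to∘from (v , x) = cong (v ,_) (I.strictlyInverseˡ v x)
  from∘to : ∀ y → from (to y) ≡ y
  from∘to (v , x) = cong (v ,_) (I.strictlyInverseʳ v x)

subst-reindex : (G G′ : Graph) (f : V G′ → V G) (g : V G → V G′) →
  (∀ v → f (g v) ≡ v) → (∀ a → g (f a) ≡ a) →
  (∀ a b → ¬ a ≡ b → E G (f a) (f b) ≡ E G′ a b) → (H : V G → Graph) →
  substG G′ (H ∘ f) ≅ substG G H
subst-reindex G G′ f g f∘g g∘f f-edges H =
  mk≅ to from to∘from from∘to (λ _ → refl)
      (subst-edges G′ G (H ∘ f) H f (λ _ x → x) f-injective f-edges (λ _ _ _ → refl))
  where
  B = λ v → V (H v)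
  to : V (substG G′ (H ∘ f)) → V (substG G H)
  to (a , x) = f a , x
  from : V (substG G H) → V (substG G′ (H ∘ f))
  from (v , y) = g v , subst B (sym (f∘g v)) y
  to∘from : ∀ y → to (from y) ≡ y
  to∘from (v , y) = Σ-≡,≡→≡ (f∘g v , subst-subst-sym (f∘g v))
  from∘to : ∀ y → from (to y) ≡ y
  from∘to (a , x) = transport-along (g∘f a) (f∘g (f a))
    where
    transport-along : ∀ {a′} (p : a′ ≡ a) (q : f a′ ≡ f a) →
                      _≡_ {A = V (substG G′ (H ∘ f))} (a′ , subst B (sym q) x) (a , x)
    transport-along refl refl = refl
  f-injective : ∀ {a b} → ¬ a ≡ b → ¬ f a ≡ f b
  f-injective a≢b fa≡fb = a≢b (trans (sym (g∘f _)) (trans (cong g fa≡fb) (g∘f _)))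

-- Substitution ignores the labels of the index graph, so any one-vertex graph indexes a single slot.
point : Graph
point = atomG (var 0)

subst-point : (H : ⊤ → Graph) → substG point H ≅ H tt
subst-point H = mk≅ proj₂ (tt ,_) (λ _ → refl) (λ _ → refl) (λ _ → refl)
  (λ (tt , x) (tt , y) → sym (E-subst-same point H tt x y))

subst-join : (G₁ G₂ : Graph) (c : V G₁ → Bool) (H : V G₁ ⊎ V G₂ → Graph) →
             substG (joinG G₁ G₂ c) H
             ≅ joinG (substG G₁ (H ∘ inj₁)) (substG G₂ (H ∘ inj₂)) (c ∘ proj₁)
subst-join G₁ G₂ c H = mk≅ to from to∘from from∘to labels edges
  where
  G₁G₂ = joinG G₁ G₂ c
  S₁ = substG G₁ (H ∘ inj₁)
  S₂ = substG G₂ (H ∘ inj₂)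
  to : V (substG G₁G₂ H) → V S₁ ⊎ V S₂
  to (inj₁ v , x) = inj₁ (v , x)
  to (inj₂ v , x) = inj₂ (v , x)
  from : V S₁ ⊎ V S₂ → V (substG G₁G₂ H)
  from (inj₁ (v , x)) = inj₁ v , x
  from (inj₂ (v , x)) = inj₂ v , x
  to∘from : ∀ y → to (from y) ≡ y
  to∘from (inj₁ _) = refl
  to∘from (inj₂ _) = refl
  from∘to : ∀ y → from (to y) ≡ y
  from∘to (inj₁ _ , _) = refl
  from∘to (inj₂ _ , _) = refl
  labels : ∀ p → label (joinG S₁ S₂ (c ∘ proj₁)) (to p) ≡ label (substG G₁G₂ H) p
  labels (inj₁ _ , _) = refl
  labels (inj₂ _ , _) = refl
  E-side₁ : ∀ p q → E (substG G₁G₂ H) (inj₁ (proj₁ p) , proj₂ p) (inj₁ (proj₁ q) , proj₂ q) ≡ E S₁ p q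
  E-side₁ = subst-edges G₁ G₁G₂ (H ∘ inj₁) H inj₁ (λ _ x → x) (_∘ inj₁-injective)
                        (λ v w _ → E-join G₁ G₂ c (inj₁ v) (inj₁ w)) (λ _ _ _ → refl)
  E-side₂ : ∀ p q → E (substG G₁G₂ H) (inj₂ (proj₁ p) , proj₂ p) (inj₂ (proj₁ q) , proj₂ q) ≡ E S₂ p q
  E-side₂ = subst-edges G₂ G₁G₂ (H ∘ inj₂) H inj₂ (λ _ x → x) (_∘ inj₂-injective)
                        (λ v w _ → E-join G₁ G₂ c (inj₂ v) (inj₂ w)) (λ _ _ _ → refl)
  join-edges : ∀ p q → join-edge S₁ S₂ (c ∘ proj₁) (to p) (to q) ≡ E (substG G₁G₂ H) p q
  join-edges (inj₁ v , x) (inj₁ w , y) = sym (E-side₁ (v , x) (w , y))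
  join-edges (inj₁ v , x) (inj₂ w , y) =
    sym (trans (E-subst-distinct G₁G₂ H x y (λ ())) (E-join G₁ G₂ c (inj₁ v) (inj₂ w)))
  join-edges (inj₂ v , x) (inj₁ w , y) =
    sym (trans (E-subst-distinct G₁G₂ H x y (λ ())) (E-join G₁ G₂ c (inj₂ v) (inj₁ w)))
  join-edges (inj₂ v , x) (inj₂ w , y) = sym (E-side₂ (v , x) (w , y))
  edges : ∀ p q → E (joinG S₁ S₂ (c ∘ proj₁)) (to p) (to q) ≡ E (substG G₁G₂ H) p q
  edges p q = trans (E-join S₁ S₂ (c ∘ proj₁) (to p) (to q)) (join-edges p q)

subst-one : (G : Graph) (a : V G) → (∀ v → v ≡ a) → (H : V G → Graph) → substG G H ≅ H a
subst-one G a only-a H =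
  ≅-trans (≅-sym (subst-reindex G point (const a) (const tt) (sym ∘ only-a) (λ _ → refl)
                                (λ { tt tt tt≢tt → ⊥-elim (tt≢tt refl) }) H))
          (subst-point (λ _ → H a))

subst-two : (G : Graph) (a b : V G) → ¬ a ≡ b → (∀ v → v ≡ a ⊎ v ≡ b) → (H : V G → Graph) →
            substG G H ≅ joinG (H a) (H b) (const (E G a b))
subst-two G a b a≢b a-or-b H =
  ≅-trans (≅-sym (subst-reindex G two f g f∘g g∘f f-edges H))
          (≅-trans (subst-join point point _ (H ∘ f))
                   (join-cong (subst-point _) (subst-point _) (λ _ → refl)))
  where
  two = joinG point point (const (E G a b))
  f : ⊤ ⊎ ⊤ → V G
  f = [ const a , const b ]
  g : V G → ⊤ ⊎ ⊤
  g v = Sum.map (const tt) (const tt) (a-or-b v)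
  f∘g : ∀ v → f (g v) ≡ v
  f∘g v with a-or-b v
  ... | inj₁ v≡a = sym v≡a
  ... | inj₂ v≡b = sym v≡b
  g∘f : ∀ x → g (f x) ≡ x
  g∘f (inj₁ tt) with a-or-b a
  ... | inj₁ _ = refl
  ... | inj₂ a≡b = ⊥-elim (a≢b a≡b)
  g∘f (inj₂ tt) with a-or-b b
  ... | inj₁ b≡a = ⊥-elim (a≢b (sym b≡a))
  ... | inj₂ _ = refl
  f-edges : ∀ x y → ¬ x ≡ y → E G (f x) (f y) ≡ E two x y
  f-edges (inj₁ tt) (inj₁ tt) x≢y = ⊥-elim (x≢y refl)
  f-edges (inj₁ tt) (inj₂ tt) _ = sym (E-join point point _ (inj₁ tt) (inj₂ tt))
  f-edges (inj₂ tt) (inj₁ tt) _ = trans (E-sym G b a) (sym (E-join point point _ (inj₂ tt) (inj₁ tt)))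
  f-edges (inj₂ tt) (inj₂ tt) x≢y = ⊥-elim (x≢y refl)

-- Induced subgraphs and contraction of a module
Subset : {A : Set} → (A → Bool) → Set
Subset {A} P = Σ A (T ∘ P)

Subset-≡ : {A : Set} (P : A → Bool) {a b : Subset P} → proj₁ a ≡ proj₁ b → a ≡ b
Subset-≡ P {v , p} {.v , q} refl = cong (v ,_) (T-irrelevant p q)

restrict : {A : Set} (P : A → Bool) → List A → List (Subset P)
restrict P [] = []
restrict P (x ∷ xs) with T? (P x)
... | yes p = (x , p) ∷ restrict P xs
... | no _ = restrict P xs

module _ {A : Set} (P : A → Bool) where

  ∈-restrict : ∀ {xs} (a : Subset P) → proj₁ a ∈ xs → a ∈ restrict P xs
  ∈-restrict {x ∷ xs} (x , p) (here refl) with T? (P x)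
  ... | yes p′ = here (Subset-≡ P refl)
  ... | no ¬p = ⊥-elim (¬p p)
  ∈-restrict {y ∷ xs} a (there a∈xs) with T? (P y)
  ... | yes _ = there (∈-restrict a a∈xs)
  ... | no _ = ∈-restrict a a∈xs

  restrict-length : ∀ xs → length (restrict P xs) ≤ length xs
  restrict-length [] = z≤n
  restrict-length (x ∷ xs) with T? (P x)
  ... | yes _ = s≤s (restrict-length xs)
  ... | no _ = m≤n⇒m≤1+n (restrict-length xs)

  restrict-length-< : ∀ {xs x} → x ∈ xs → ¬ T (P x) → length (restrict P xs) < length xs
  restrict-length-< {x ∷ xs} (here refl) ¬Px with T? (P x)
  ... | yes Px = ⊥-elim (¬Px Px)
  ... | no _ = s≤s (restrict-length xs)
  restrict-length-< {y ∷ xs} (there x∈xs) ¬Px with T? (P y)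
  ... | yes _ = s≤s (restrict-length-< x∈xs ¬Px)
  ... | no _ = m≤n⇒m≤1+n (restrict-length-< x∈xs ¬Px)

  restrict-length-<₂ : ∀ {xs x y} → x ∈ xs → y ∈ xs → ¬ x ≡ y → ¬ T (P x) → ¬ T (P y) →
                       suc (length (restrict P xs)) < length xs
  restrict-length-<₂ {z ∷ xs} (here refl) (here refl) x≢y _ _ = ⊥-elim (x≢y refl)
  restrict-length-<₂ {z ∷ xs} (here refl) (there y∈xs) _ ¬Px ¬Py with T? (P z)
  ... | yes Px = ⊥-elim (¬Px Px)
  ... | no _ = s≤s (restrict-length-< y∈xs ¬Py)
  restrict-length-<₂ {z ∷ xs} (there x∈xs) (here refl) _ ¬Px ¬Py with T? (P z)
  ... | yes Py = ⊥-elim (¬Py Py)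
  ... | no _ = s≤s (restrict-length-< x∈xs ¬Px)
  restrict-length-<₂ {z ∷ xs} (there x∈xs) (there y∈xs) x≢y ¬Px ¬Py with T? (P z)
  ... | yes _ = s≤s (restrict-length-<₂ x∈xs y∈xs x≢y ¬Px ¬Py)
  ... | no _ = m≤n⇒m≤1+n (restrict-length-<₂ x∈xs y∈xs x≢y ¬Px ¬Py)

induce : (G : Graph) → (V G → Bool) → Graph
induce G P = record
  { V = Subset P
  ; _≟V_ = λ a b → map′ (Subset-≡ P) (cong proj₁) (_≟V_ G (proj₁ a) (proj₁ b))
  ; elems = restrict P (elems G)
  ; complete = λ a → ∈-restrict P a (complete G (proj₁ a))
  ; label = label G ∘ proj₁
  ; adj = λ a b → adj G (proj₁ a) (proj₁ b) }

E-induce : (G : Graph) (P : V G → Bool) (a b : Subset P) → E (induce G P) a b ≡ E G (proj₁ a) (proj₁ b)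
E-induce G P (v , _) (w , _) =
  cong (λ b → not b ∧ (adj G v w ∨ adj G w v)) (⌊⌋-map′ _ _ (_≟V_ G v w))

E-subst-induce : (G : Graph) (P : V G → Bool) (H : V G → Graph) → ∀ p q →
                 E (substG G H) (proj₁ (proj₁ p) , proj₂ p) (proj₁ (proj₁ q) , proj₂ q)
                 ≡ E (substG (induce G P) (H ∘ proj₁)) p q
E-subst-induce G P H =
  subst-edges (induce G P) G (H ∘ proj₁) H proj₁ (λ _ x → x) (λ a≢b → a≢b ∘ Subset-≡ P)
              (λ a b _ → sym (E-induce G P a b)) (λ _ _ _ → refl)

subst-induce : (G : Graph) (P : V G → Bool) (H : V G → Graph) → (∀ v → ¬ T (P v) → ¬ V (H v)) →
               substG (induce G P) (H ∘ proj₁) ≅ substG G H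
subst-induce G P H empty-outside = mk≅ to from (λ _ → refl) from∘to (λ _ → refl) (E-subst-induce G P H)
  where
  inside : ∀ v → V (H v) → T (P v)
  inside v x with T? (P v)
  ... | yes Pv = Pv
  ... | no ¬Pv = ⊥-elim (empty-outside v ¬Pv x)
  to : V (substG (induce G P) (H ∘ proj₁)) → V (substG G H)
  to ((v , _) , x) = v , x
  from : V (substG G H) → V (substG (induce G P) (H ∘ proj₁))
  from (v , x) = (v , inside v x) , x
  from∘to : ∀ y → from (to y) ≡ y
  from∘to ((v , p) , x) = cong (λ p → (v , p) , x) (T-irrelevant _ p)

compl-induce : (G : Graph) (P : V G → Bool) (H : Subset P → Graph) →
               substG (compl (induce G P)) H ≅ substG (induce (compl G) P) H
compl-induce G P =
  subst-reindex (induce (compl G) P) (compl (induce G P)) id id (λ _ → refl) (λ _ → refl) same-edges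
  where
  same-edges : ∀ a b → ¬ a ≡ b → E (induce (compl G) P) a b ≡ E (compl (induce G P)) a b
  same-edges a b a≢b = begin
    E (induce (compl G) P) a b     ≡⟨ E-induce (compl G) P a b ⟩
    E (compl G) (proj₁ a) (proj₁ b) ≡⟨ E-compl G _ _ (a≢b ∘ Subset-≡ P) ⟩
    not (E G (proj₁ a) (proj₁ b))   ≡⟨ cong not (E-induce G P a b) ⟨
    not (E (induce G P) a b)        ≡⟨ E-compl (induce G P) a b a≢b ⟨
    E (compl (induce G P)) a b      ∎
    where open ≡-Reasoning

T-not⁺ : ∀ {b} → ¬ T b → T (not b)
T-not⁺ {false} _ = tt
T-not⁺ {true} ¬T = ¬T tt

T-not⁻ : ∀ {b} → T (not b) → ¬ T b
T-not⁻ {false} _ ()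

outside≢inside : {A : Set} (S : A → Bool) {a y : A} → T (not (S a)) → T (S y) → ¬ a ≡ y
outside≢inside S ¬Sa Sy refl = T-not⁻ ¬Sa Sy

module Contraction (G : Graph) (S : V G → Bool) (c : V G → Bool)
  (c-spec : ∀ {a y} → T (not (S a)) → T (S y) → E G a y ≡ c a) where

  outside = induce G (not ∘ S)
  inside = induce G S

  quotient : Graph
  quotient = joinG outside point (c ∘ proj₁)

  E-quotient : ∀ x y → E quotient x y ≡ join-edge outside point (c ∘ proj₁) x y
  E-quotient = E-join outside point (c ∘ proj₁)

  subst-quotient-plug : (M : V G → Graph) (Y : Graph) →
    substG quotient [ M ∘ proj₁ , const Y ] ≅ plug (substG outside (M ∘ proj₁)) (c ∘ proj₁ ∘ proj₁) Y
  subst-quotient-plug M Y =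
    ≅-trans (subst-join outside point (c ∘ proj₁) _) (join-cong ≅-refl (subst-point _) (λ _ → refl))

  subst-partition : (M : V G → Graph) →
    plug (substG outside (M ∘ proj₁)) (c ∘ proj₁ ∘ proj₁) (substG inside (M ∘ proj₁)) ≅ substG G M
  subst-partition M = mk≅ to from to∘from from∘to labels edges
    where
    Out = substG outside (M ∘ proj₁)
    In = substG inside (M ∘ proj₁)
    to : V Out ⊎ V In → V (substG G M)
    to (inj₁ ((v , _) , x)) = v , x
    to (inj₂ ((v , _) , x)) = v , x
    from : V (substG G M) → V Out ⊎ V In
    from (v , x) with T? (S v)
    ... | yes Sv = inj₂ ((v , Sv) , x)
    ... | no ¬Sv = inj₁ ((v , T-not⁺ ¬Sv) , x)
    to∘from : ∀ y → to (from y) ≡ y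
    to∘from (v , x) with T? (S v)
    ... | yes _ = refl
    ... | no _ = refl
    from∘to : ∀ y → from (to y) ≡ y
    from∘to (inj₁ ((v , ¬Sv) , x)) with T? (S v)
    ... | yes Sv = ⊥-elim (T-not⁻ ¬Sv Sv)
    ... | no _ = cong (λ p → inj₁ ((v , p) , x)) (T-irrelevant _ _)
    from∘to (inj₂ ((v , Sv) , x)) with T? (S v)
    ... | yes _ = cong (λ p → inj₂ ((v , p) , x)) (T-irrelevant _ _)
    ... | no ¬Sv = ⊥-elim (¬Sv Sv)
    labels : ∀ y → label (substG G M) (to y) ≡ label (joinG Out In (c ∘ proj₁ ∘ proj₁)) y
    labels (inj₁ _) = refl
    labels (inj₂ _) = refl
    join-edges : ∀ y z → E (substG G M) (to y) (to z) ≡ join-edge Out In (c ∘ proj₁ ∘ proj₁) y z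
    join-edges (inj₁ p) (inj₁ q) = E-subst-induce G (not ∘ S) M p q
    join-edges (inj₁ ((v , ¬Sv) , x)) (inj₂ ((w , Sw) , y)) =
      trans (E-subst-distinct G M x y (outside≢inside S ¬Sv Sw)) (c-spec ¬Sv Sw)
    join-edges (inj₂ ((v , Sv) , x)) (inj₁ ((w , ¬Sw) , y)) =
      trans (E-subst-distinct G M x y (outside≢inside S ¬Sw Sv ∘ sym)) (trans (E-sym G v w) (c-spec ¬Sw Sv))
    join-edges (inj₂ p) (inj₂ q) = E-subst-induce G S M p q
    edges : ∀ y z → E (substG G M) (to y) (to z) ≡ E (joinG Out In (c ∘ proj₁ ∘ proj₁)) y z
    edges y z = trans (join-edges y z) (sym (E-join Out In (c ∘ proj₁ ∘ proj₁) y z))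

  subst-quotient : (M : V G → Graph) →
    substG quotient [ M ∘ proj₁ , const (substG inside (M ∘ proj₁)) ] ≅ substG G M
  subst-quotient M = ≅-trans (subst-quotient-plug M _) (subst-partition M)

-- Modules and primality
Nontrivial : (G : Graph) → (V G → Bool) → Set
Nontrivial G S =
  Σ (V G) λ u → Σ (V G) λ w → Σ (V G) λ z → S u ≡ true × S w ≡ true × ¬ u ≡ w × S z ≡ false

HasNontrivialModule : Graph → Set
HasNontrivialModule G = Σ (V G → Bool) λ S → IsModule G S × Nontrivial G S

sublists : {A : Set} → List A → List (List A)
sublists [] = [] ∷ []
sublists (x ∷ xs) = map (x ∷_) (sublists xs) ++ sublists xs

filter-∈-sublists : {A : Set} {P : A → Set} (P? : ∀ x → Dec (P x)) (xs : List A) →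
                    filter P? xs ∈ sublists xs
filter-∈-sublists P? [] = here refl
filter-∈-sublists P? (x ∷ xs) with does (P? x)
... | true = ∈-++⁺ˡ (∈-map⁺ (x ∷_) (filter-∈-sublists P? xs))
... | false = ∈-++⁺ʳ (map (x ∷_) (sublists xs)) (filter-∈-sublists P? xs)

module _ (G : Graph) where

  module? : (S : V G → Bool) → Dec (IsModule G S)
  module? S = ∀? G λ x → (S x ≟ false) →-dec (uniformly x true ⊎-dec uniformly x false)
    where
    uniformly : (x : V G) (b : Bool) → Dec (∀ y → S y ≡ true → E G x y ≡ b)
    uniformly x b = ∀? G λ y → (S y ≟ true) →-dec (E G x y ≟ b)

  nontrivial? : (S : V G → Bool) → Dec (Nontrivial G S)
  nontrivial? S = ∃? G λ u → ∃? G λ w → ∃? G λ z →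
    (S u ≟ true) ×-dec (S w ≟ true) ×-dec ¬? (_≟V_ G u w) ×-dec (S z ≟ false)

  module-resp : ∀ {S S′} → (∀ v → S v ≡ S′ v) → IsModule G S → IsModule G S′
  module-resp S≗S′ m x S′x with m x (trans (S≗S′ x) S′x)
  ... | inj₁ adjacent = inj₁ (λ y S′y → adjacent y (trans (S≗S′ y) S′y))
  ... | inj₂ apart = inj₂ (λ y S′y → apart y (trans (S≗S′ y) S′y))

  nontrivial-resp : ∀ {S S′} → (∀ v → S v ≡ S′ v) → Nontrivial G S → Nontrivial G S′
  nontrivial-resp S≗S′ (u , w , z , Su , Sw , u≢w , Sz) =
    u , w , z , trans (sym (S≗S′ u)) Su , trans (sym (S≗S′ w)) Sw , u≢w , trans (sym (S≗S′ z)) Sz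

  member : List (V G) → V G → Bool
  member L v = ⌊ DecMembership._∈?_ (_≟V_ G) v L ⌋

  member-filter : ∀ (S : V G → Bool) v → S v ≡ member (filter (λ v → S v ≟ true) (elems G)) v
  member-filter S v with DecMembership._∈?_ (_≟V_ G) v (filter (λ v → S v ≟ true) (elems G))
  ... | yes v∈ = proj₂ (∈-filter⁻ (λ v → S v ≟ true) {xs = elems G} v∈)
  ... | no v∉ = ¬-not (λ Sv → v∉ (∈-filter⁺ (λ v → S v ≟ true) (complete G v) Sv))

  -- Each S agrees pointwise with member L for the sublist L = filter S (elems G), so searching sublists suffices.
  nontrivial-module? : Dec (HasNontrivialModule G)
  nontrivial-module? with any? (λ L → module? (member L) ×-dec nontrivial? (member L)) (sublists (elems G))
  ... | yes found = yes (_ , proj₂ (satisfied found))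
  ... | no none = no λ (S , S-module , S-nontrivial) →
    none (lose (filter-∈-sublists (λ v → S v ≟ true) (elems G))
               (module-resp (member-filter S) S-module , nontrivial-resp (member-filter S) S-nontrivial))

module _ (G : Graph) (module-free : ¬ HasNontrivialModule G) where

  prime : AtLeast 2 G → Prime G
  prime at-least-2 = at-least-2 , trichotomy
    where
    trichotomy : ∀ S → IsModule G S →
      (∀ v → S v ≡ false)
      ⊎ (Σ (V G) λ v → S v ≡ true × (∀ w → S w ≡ true → w ≡ v))
      ⊎ (∀ v → S v ≡ true)
    trichotomy S S-module with ∃? G (λ v → S v ≟ true) | ∃? G (λ v → S v ≟ false)
    ... | no none-in | _ = inj₁ (λ v → ¬-not (λ Sv → none-in (v , Sv)))
    ... | yes _ | no none-out = inj₂ (inj₂ (λ v → ¬-not (λ Sv → none-out (v , Sv))))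
    ... | yes (u , Su) | yes (z , Sz) = inj₂ (inj₁ (u , Su , singleton))
      where
      singleton : ∀ w → S w ≡ true → w ≡ u
      singleton w Sw with _≟V_ G w u
      ... | yes w≡u = w≡u
      ... | no w≢u = ⊥-elim (module-free (S , S-module , u , w , z , Su , Sw , w≢u ∘ sym , Sz))

  compl-module-free : ¬ HasNontrivialModule (compl G)
  compl-module-free (S , S-module , S-nontrivial) = module-free (S , module-of-compl , S-nontrivial)
    where
    separated : ∀ {a y} → S a ≡ false → S y ≡ true → ¬ a ≡ y
    separated Sa Sy refl = not-¬ Sa Sy
    module-of-compl : IsModule G S
    module-of-compl x Sx with S-module x Sx
    ... | inj₁ adjacent = inj₂ (λ y Sy → not-injective (trans (sym (E-compl G x y (separated Sx Sy)))
                                                              (adjacent y Sy)))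
    ... | inj₂ apart    = inj₁ (λ y Sy → not-injective (trans (sym (E-compl G x y (separated Sx Sy)))
                                                              (apart y Sy)))

pair-module : (G : Graph) {x y z : V G} → ¬ x ≡ y → ¬ x ≡ z → (∀ v → v ≡ x ⊎ v ≡ y ⊎ v ≡ z) →
              E G x y ≡ E G x z → ¬ y ≡ z → HasNontrivialModule G
pair-module G {x} {y} {z} x≢y x≢z covered same-edge y≢z =
  S , S-module , y , z , x , S-true (inj₁ refl) , S-true (inj₂ refl) , y≢z , S-false x-outside
  where
  S : V G → Bool
  S v = ⌊ _≟V_ G v y ⊎-dec _≟V_ G v z ⌋
  S-true : ∀ {v} → v ≡ y ⊎ v ≡ z → S v ≡ true
  S-true = Equivalence.to T-≡ ∘ fromWitness
  S-false : ∀ {v} → ¬ (v ≡ y ⊎ v ≡ z) → S v ≡ false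
  S-false = Equivalence.to T-not-≡ ∘ fromWitnessFalse
  x-outside : ¬ (x ≡ y ⊎ x ≡ z)
  x-outside (inj₁ x≡y) = x≢y x≡y
  x-outside (inj₂ x≡z) = x≢z x≡z
  only-x-outside : ∀ v → S v ≡ false → v ≡ x
  only-x-outside v Sv with covered v
  ... | inj₁ v≡x = v≡x
  ... | inj₂ v∈S = ⊥-elim (not-¬ (S-true v∈S) Sv)
  same-edge-from-x : ∀ w → S w ≡ true → E G x w ≡ E G x y
  same-edge-from-x w Sw with toWitness (Equivalence.from T-≡ Sw)
  ... | inj₁ refl = refl
  ... | inj₂ refl = sym same-edge
  S-module : IsModule G S
  S-module v Sv with only-x-outside v Sv | E G x y in x-y
  ... | refl | true = inj₁ (λ w Sw → trans (same-edge-from-x w Sw) x-y)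
  ... | refl | false = inj₂ (λ w Sw → trans (same-edge-from-x w Sw) x-y)

Bool-pigeonhole : (b₁ b₂ b₃ : Bool) → b₁ ≡ b₂ ⊎ b₁ ≡ b₃ ⊎ b₂ ≡ b₃
Bool-pigeonhole false false _ = inj₁ refl
Bool-pigeonhole true true _ = inj₁ refl
Bool-pigeonhole false true false = inj₂ (inj₁ refl)
Bool-pigeonhole false true true = inj₂ (inj₂ refl)
Bool-pigeonhole true false false = inj₂ (inj₂ refl)
Bool-pigeonhole true false true = inj₂ (inj₁ refl)

three-vertices-module : (G : Graph) {a b c : V G} → ¬ a ≡ b → ¬ a ≡ c → ¬ b ≡ c →
                        (∀ v → v ≡ a ⊎ v ≡ b ⊎ v ≡ c) → HasNontrivialModule G
three-vertices-module G {a} {b} {c} a≢b a≢c b≢c covered with Bool-pigeonhole (E G a b) (E G a c) (E G b c)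
... | inj₁ ab≡ac = pair-module G a≢b a≢c covered ab≡ac b≢c
... | inj₂ (inj₁ ab≡bc) =
  pair-module G (a≢b ∘ sym) b≢c ([ inj₂ ∘ inj₁ , [ inj₁ , inj₂ ∘ inj₂ ] ] ∘ covered)
              (trans (E-sym G b a) ab≡bc) a≢c
... | inj₂ (inj₂ ac≡bc) =
  pair-module G (a≢c ∘ sym) (b≢c ∘ sym) ([ inj₂ ∘ inj₁ , [ inj₂ ∘ inj₂ , inj₁ ] ] ∘ covered)
              (trans (E-sym G c a) (trans ac≡bc (E-sym G b c))) a≢b

module _ (G : Graph) where

  unique-atLeast : (xs : List (V G)) → Unique xs → AtLeast (length xs) G
  unique-atLeast xs xs-unique = List.lookup xs , lookup-injective xs xs-unique
    where
    lookup-injective : ∀ xs → Unique xs → ∀ {i j} → List.lookup xs i ≡ List.lookup xs j → i ≡ j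
    lookup-injective (x ∷ xs) _ {Fin.zero} {Fin.zero} _ = refl
    lookup-injective (x ∷ xs) (x∉xs ∷ _) {Fin.zero} {Fin.suc j} x≡xⱼ = ⊥-elim (All.lookup x∉xs (∈-lookup j) x≡xⱼ)
    lookup-injective (x ∷ xs) (x∉xs ∷ _) {Fin.suc i} {Fin.zero} xᵢ≡x =
      ⊥-elim (All.lookup x∉xs (∈-lookup i) (sym xᵢ≡x))
    lookup-injective (x ∷ xs) (_ ∷ xs-unique) {Fin.suc i} {Fin.suc j} eq =
      cong Fin.suc (lookup-injective xs xs-unique eq)

  atLeast-weaken : ∀ {k n} → k ≤ n → AtLeast n G → AtLeast k G
  atLeast-weaken k≤n (f , f-injective) =
    (λ i → f (inject≤ i k≤n)) , inject≤-injective k≤n k≤n _ _ ∘ f-injective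

module _ {R : Graph → Graph → Set₁} where

  iso-derivation : {X Y : Graph} → X ≅ Y → Derivation R X Y
  iso-derivation i = isoStep i ◅ ε

  rule-derivation : {X Y : Graph} → R X Y → Derivation R X Y
  rule-derivation {X} {Y} r =
    isoStep (≅-sym (plug-∅ (λ ()) X)) ◅ ruleStep ∅G (λ ()) r ◅ isoStep (plug-∅ (λ ()) Y) ◅ ε

  plug-step : (C : Graph) (Rs : V C → Bool) {X Y : Graph} → Step R X Y →
              Derivation R (plug C Rs X) (plug C Rs Y)
  plug-step C Rs (isoStep i) = iso-derivation (join-cong ≅-refl i (λ _ → refl))
  plug-step C Rs (ruleStep D S {X} {Y} r) =
    isoStep (plug-assoc C Rs D S X)
    ◅ ruleStep (plug C Rs D) [ Rs , S ] r
    ◅ isoStep (≅-sym (plug-assoc C Rs D S Y))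
    ◅ ε

  plug-derivation : (C : Graph) (Rs : V C → Bool) {X Y : Graph} → Derivation R X Y →
                    Derivation R (plug C Rs X) (plug C Rs Y)
  plug-derivation C Rs ε = ε
  plug-derivation C Rs (s ◅ d) = plug-step C Rs s ◅◅ plug-derivation C Rs d

-- Where a side condition of ss↓ or ss↑ fails, the premise and conclusion are isomorphic.
switch↓ : (B A : Graph) (S : V B → Bool) → Derivation SGS↓ (plug B S A) (B ⊔G A)
switch↓ B A S with nonempty? A | ∃? B (λ v → S v ≟ true)
... | no ¬A | _ = iso-derivation (join-cross-cong B A (λ _ a → ⊥-elim (¬A a)))
... | yes a | yes s = rule-derivation (ss↓ B A S s a)
... | yes _ | no ¬s = iso-derivation (join-cross-cong B A (λ v _ → ¬-not (λ Sv → ¬s (v , Sv))))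

switch↑ : (B A : Graph) (S : V B → Bool) → Derivation SGS↑ (B ⊗G A) (plug B S A)
switch↑ B A S with nonempty? A | ∃? B (λ v → S v ≟ false)
... | no ¬A | _ = iso-derivation (join-cross-cong B A (λ _ a → ⊥-elim (¬A a)))
... | yes a | yes s = rule-derivation (ss↑ B A S s a)
... | yes _ | no ¬s = iso-derivation (join-cross-cong B A (λ v _ → sym (¬-not (λ Sv → ¬s (v , Sv)))))

switch-tensor↓ : (Ma Na Mb Nb : Graph) →
                 Derivation SGS↓ ((Ma ⊔G Na) ⊗G (Mb ⊔G Nb)) ((Ma ⊗G Mb) ⊔G (Na ⊔G Nb))
switch-tensor↓ Ma Na Mb Nb =
  iso-derivation Na-beside-W
  ◅◅ switch↓ (Ma ⊗G W) Na [ const false , const true ]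
  ◅◅ iso-derivation (join-comm (Ma ⊗G W) Na false)
  ◅◅ plug-derivation Na (const false)
       (iso-derivation (plug-assoc Ma (const true) Mb (const false) Nb)
        ◅◅ switch↓ (Ma ⊗G Mb) Nb [ const true , const false ])
  ◅◅ iso-derivation regroup
  where
  W = Mb ⊔G Nb
  Na-beside-W : ((Ma ⊔G Na) ⊗G W) ≅ plug (Ma ⊗G W) [ const false , const true ] Na
  Na-beside-W = ≅-trans (join-comm (Ma ⊔G Na) W true)
    (≅-trans (plug-assoc W (const true) Ma (const false) Na)
             (join-cong (join-comm W Ma true) ≅-refl λ { (inj₁ _) → refl ; (inj₂ _) → refl }))
  regroup : (Na ⊔G ((Ma ⊗G Mb) ⊔G Nb)) ≅ ((Ma ⊗G Mb) ⊔G (Na ⊔G Nb))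
  regroup = ≅-trans (join-assoc Na (Ma ⊗G Mb) Nb false)
    (≅-trans (join-cong (join-comm Na (Ma ⊗G Mb) false) ≅-refl (λ _ → refl))
             (≅-sym (join-assoc (Ma ⊗G Mb) Na Nb false)))

switch-tensor↑ : (Ma Mb Na Nb : Graph) →
                 Derivation SGS↑ ((Ma ⊗G Mb) ⊗G (Na ⊔G Nb)) ((Ma ⊗G Na) ⊔G (Mb ⊗G Nb))
switch-tensor↑ Ma Mb Na Nb =
  iso-derivation Mb-outside
  ◅◅ plug-derivation Mb (const true) (switch↑ W Ma [ const true , const false ])
  ◅◅ iso-derivation regroup
  ◅◅ switch↑ (K ⊔G Nb) Mb [ const false , const true ]
  ◅◅ iso-derivation Mb-beside-Nb
  where
  W = Na ⊔G Nb
  K = Ma ⊗G Na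
  Mb-outside : ((Ma ⊗G Mb) ⊗G W) ≅ (Mb ⊗G (W ⊗G Ma))
  Mb-outside = ≅-trans (join-cong (join-comm Ma Mb true) ≅-refl (λ _ → refl))
    (≅-trans (≅-sym (join-assoc Mb Ma W true)) (join-cong ≅-refl (join-comm Ma W true) (λ _ → refl)))
  regroup : (Mb ⊗G plug W [ const true , const false ] Ma) ≅ ((K ⊔G Nb) ⊗G Mb)
  regroup = ≅-trans (join-comm Mb _ true) (join-cong Ma-beside-Na ≅-refl (λ _ → refl))
    where
    Ma-beside-Na : plug W [ const true , const false ] Ma ≅ (K ⊔G Nb)
    Ma-beside-Na =
      ≅-trans (join-cong (join-comm Na Nb false) ≅-refl λ { (inj₁ _) → refl ; (inj₂ _) → refl })
      (≅-trans (≅-sym (plug-assoc Nb (const false) Na (const true) Ma))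
      (≅-trans (join-comm Nb (Na ⊗G Ma) false) (join-cong (join-comm Na Ma true) ≅-refl (λ _ → refl))))
  Mb-beside-Nb : plug (K ⊔G Nb) [ const false , const true ] Mb ≅ (K ⊔G (Mb ⊗G Nb))
  Mb-beside-Nb = ≅-trans (≅-sym (plug-assoc K (const false) Nb (const true) Mb))
    (join-cong ≅-refl (join-comm Nb Mb true) (λ _ → refl))

switch-pair↓ : (Ma Na Mb Nb : Graph) (e : Bool) →
  Derivation SGS↓ ((Ma ⊔G Na) ⊗G (Mb ⊔G Nb)) (joinG Ma Mb (const e) ⊔G joinG Na Nb (const (not e)))
switch-pair↓ Ma Na Mb Nb true = switch-tensor↓ Ma Na Mb Nb
switch-pair↓ Ma Na Mb Nb false =
  iso-derivation (join-cong (join-comm Ma Na false) (join-comm Mb Nb false) (λ _ → refl))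
  ◅◅ switch-tensor↓ Na Ma Nb Mb
  ◅◅ iso-derivation (join-comm (Na ⊗G Nb) (Ma ⊔G Mb) false)

switch-pair↑ : (Ma Mb Na Nb : Graph) (e : Bool) →
  Derivation SGS↑ (joinG Ma Mb (const e) ⊗G joinG Na Nb (const (not e))) ((Ma ⊗G Na) ⊔G (Mb ⊗G Nb))
switch-pair↑ Ma Mb Na Nb true = switch-tensor↑ Ma Mb Na Nb
switch-pair↑ Ma Mb Na Nb false =
  iso-derivation (join-comm (Ma ⊔G Mb) (Na ⊗G Nb) true)
  ◅◅ switch-tensor↑ Na Nb Ma Mb
  ◅◅ iso-derivation (join-cong (join-comm Na Ma true) (join-comm Nb Mb true) (λ _ → refl))

PrimeRules : (G : Graph) (M N : V G → Graph) → Set₁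
PrimeRules G M N =
  Derivation SGS↓ (⨂ G (λ v → M v ⊔G N v)) (substG G M ⊔G substG (compl G) N)
  × Derivation SGS↑ (substG G M ⊗G substG (compl G) N) (⨆ G (λ v → M v ⊗G N v))

module _ (G : Graph) (M N : V G → Graph) where

  prime-rules-empty : ¬ V G → PrimeRules G M N
  prime-rules-empty ¬G = iso-derivation (≅-empty (¬G ∘ proj₁) [ ¬G ∘ proj₁ , ¬G ∘ proj₁ ])
                       , iso-derivation (≅-empty [ ¬G ∘ proj₁ , ¬G ∘ proj₁ ] (¬G ∘ proj₁))

  prime-rules-one : (a : V G) → (∀ v → v ≡ a) → PrimeRules G M N
  prime-rules-one a only-a =
    iso-derivation (≅-trans (subst-one (uniform true G) a only-a _) (≅-sym (both false)))
    , iso-derivation (≅-trans (both true) (≅-sym (subst-one (uniform false G) a only-a _)))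
    where
    both : (b : Bool) → joinG (substG G M) (substG (compl G) N) (const b) ≅ joinG (M a) (N a) (const b)
    both b = join-cong (subst-one G a only-a M) (subst-one (compl G) a only-a N) (λ _ → refl)

  prime-rules-two : (a b : V G) → ¬ a ≡ b → (∀ v → v ≡ a ⊎ v ≡ b) → PrimeRules G M N
  prime-rules-two a b a≢b a-or-b =
    iso-derivation (≅-trans (subst-two (uniform true G) a b a≢b a-or-b _)
                            (join-cross-cong _ _ (λ _ _ → E-uniform true G a≢b)))
    ◅◅ switch-pair↓ (M a) (N a) (M b) (N b) (E G a b)
    ◅◅ iso-derivation (≅-sym (both false))
    , iso-derivation (both true)
    ◅◅ switch-pair↑ (M a) (M b) (N a) (N b) (E G a b)
    ◅◅ iso-derivation (≅-sym (≅-trans (subst-two (uniform false G) a b a≢b a-or-b _)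
                                      (join-cross-cong _ _ (λ _ _ → E-uniform false G a≢b))))
    where
    both : (c : Bool) → joinG (substG G M) (substG (compl G) N) (const c)
                         ≅ joinG (joinG (M a) (M b) (const (E G a b)))
                                 (joinG (N a) (N b) (const (not (E G a b)))) (const c)
    both c = join-cong (subst-two G a b a≢b a-or-b M)
                       (≅-trans (subst-two (compl G) a b a≢b a-or-b N)
                                (join-cross-cong _ _ (λ _ _ → E-compl G a b a≢b)))
                       (λ _ → refl)

  -- p↓ is applied to the prime graph compl G, whose complement has the edges of G.
  prime-rules-prime : Prime G → Prime (compl G) → AtLeast 4 G → (∀ v → V (M v)) → PrimeRules G M N
  prime-rules-prime G-prime compl-prime at-least-4 M-nonempty =
    iso-derivation (≅-sym complete-on-compl)
    ◅◅ rule-derivation (p↓ (compl G) compl-prime at-least-4 M N M-nonempty)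
    ◅◅ iso-derivation (join-cong double-compl ≅-refl (λ _ → refl))
    , rule-derivation (p↑ G G-prime at-least-4 M N M-nonempty)
    where
    complete-on-compl : substG (uniform true (compl G)) (λ v → M v ⊔G N v) ≅ ⨂ G (λ v → M v ⊔G N v)
    complete-on-compl = subst-reindex (uniform true G) (uniform true (compl G)) id id (λ _ → refl) (λ _ → refl)
      (λ _ _ v≢w → trans (E-uniform true G v≢w) (sym (E-uniform true (compl G) v≢w))) _
    compl-compl-edges : ∀ v w → ¬ v ≡ w → E G v w ≡ E (compl (compl G)) v w
    compl-compl-edges v w v≢w = sym (begin
      E (compl (compl G)) v w ≡⟨ E-compl (compl G) v w v≢w ⟩
      not (E (compl G) v w)   ≡⟨ cong not (E-compl G v w v≢w) ⟩
      not (not (E G v w))     ≡⟨ not-involutive _ ⟩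
      E G v w                 ∎)
      where open ≡-Reasoning
    double-compl : substG (compl (compl G)) M ≅ substG G M
    double-compl = subst-reindex G (compl (compl G)) id id (λ _ → refl) (λ _ → refl) compl-compl-edges M

module ModuleCase (G : Graph) (M N : V G → Graph) (S : V G → Bool) (S-module : IsModule G S)
                  (u : V G) (Su : S u ≡ true) where

  separated : ∀ {a y} → T (not (S a)) → T (S y) → ¬ a ≡ y
  separated = outside≢inside S

  module-edge : ∀ {a y} → T (not (S a)) → T (S y) → E G a y ≡ E G a u
  module-edge {a} {y} ¬Sa Sy with S-module a (Equivalence.to T-not-≡ ¬Sa)
  ... | inj₁ adjacent = trans (adjacent y (Equivalence.to T-≡ Sy)) (sym (adjacent u Su))
  ... | inj₂ apart = trans (apart y (Equivalence.to T-≡ Sy)) (sym (apart u Su))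

  compl-module-edge : ∀ {a y} → T (not (S a)) → T (S y) → E (compl G) a y ≡ E (compl G) a u
  compl-module-edge {a} {y} ¬Sa Sy = begin
    E (compl G) a y  ≡⟨ E-compl G a y (separated ¬Sa Sy) ⟩
    not (E G a y)    ≡⟨ cong not (module-edge ¬Sa Sy) ⟩
    not (E G a u)    ≡⟨ E-compl G a u (separated ¬Sa (Equivalence.from T-≡ Su)) ⟨
    E (compl G) a u  ∎
    where open ≡-Reasoning

  uniform-module-edge : ∀ b {a y} → T (not (S a)) → T (S y) → E (uniform b G) a y ≡ b
  uniform-module-edge b ¬Sa Sy = E-uniform b G (separated ¬Sa Sy)

  module Q = Contraction G S (λ a → E G a u) module-edge
  module Qᶜ = Contraction (compl G) S (λ a → E (compl G) a u) compl-module-edge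
  module Qᵘ (b : Bool) = Contraction (uniform b G) S (const b) (uniform-module-edge b)

  inside = Q.inside
  quotient = Q.quotient

  M-inside N-inside : V inside → Graph
  M-inside = M ∘ proj₁
  N-inside = N ∘ proj₁

  M′ N′ : V quotient → Graph
  M′ = [ M ∘ proj₁ , const (substG inside M-inside) ]
  N′ = [ N ∘ proj₁ , const (substG (compl inside) N-inside) ]

  compl-quotient-edges : ∀ x y → ¬ x ≡ y → E Qᶜ.quotient x y ≡ E (compl quotient) x y
  compl-quotient-edges (inj₁ a) (inj₁ b) a≢b = begin
    E Qᶜ.quotient (inj₁ a) (inj₁ b)   ≡⟨ Qᶜ.E-quotient (inj₁ a) (inj₁ b) ⟩
    E Qᶜ.outside a b                  ≡⟨ E-induce (compl G) _ a b ⟩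
    E (compl G) (proj₁ a) (proj₁ b)   ≡⟨ E-compl G _ _ (a≢b ∘ cong inj₁ ∘ Subset-≡ _) ⟩
    not (E G (proj₁ a) (proj₁ b))     ≡⟨ cong not (E-induce G _ a b) ⟨
    not (E Q.outside a b)             ≡⟨ cong not (Q.E-quotient (inj₁ a) (inj₁ b)) ⟨
    not (E quotient (inj₁ a) (inj₁ b)) ≡⟨ E-compl quotient _ _ a≢b ⟨
    E (compl quotient) (inj₁ a) (inj₁ b) ∎
    where open ≡-Reasoning
  compl-quotient-edges (inj₁ a) (inj₂ tt) a≢t =
    trans (Qᶜ.E-quotient (inj₁ a) (inj₂ tt))
          (trans (E-compl G _ u (separated (proj₂ a) (Equivalence.from T-≡ Su)))
                 (sym (trans (E-compl quotient _ _ a≢t) (cong not (Q.E-quotient (inj₁ a) (inj₂ tt))))))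
  compl-quotient-edges (inj₂ tt) (inj₁ b) t≢b =
    trans (Qᶜ.E-quotient (inj₂ tt) (inj₁ b))
          (trans (E-compl G _ u (separated (proj₂ b) (Equivalence.from T-≡ Su)))
                 (sym (trans (E-compl quotient _ _ t≢b) (cong not (Q.E-quotient (inj₂ tt) (inj₁ b))))))
  compl-quotient-edges (inj₂ tt) (inj₂ tt) t≢t = ⊥-elim (t≢t refl)

  uniform-quotient-edges : ∀ b x y → ¬ x ≡ y → E (uniform b quotient) x y ≡ E (Qᵘ.quotient b) x y
  uniform-quotient-edges b x y x≢y = trans (E-uniform b quotient x≢y) (sym (quotient-edge x y x≢y))
    where
    quotient-edge : ∀ x y → ¬ x ≡ y → E (Qᵘ.quotient b) x y ≡ b
    quotient-edge (inj₁ a) (inj₁ a′) a≢a′ =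
      trans (Qᵘ.E-quotient b (inj₁ a) (inj₁ a′))
            (trans (E-induce (uniform b G) _ a a′) (E-uniform b G (a≢a′ ∘ cong inj₁ ∘ Subset-≡ _)))
    quotient-edge (inj₁ a) (inj₂ tt) _ = Qᵘ.E-quotient b (inj₁ a) (inj₂ tt)
    quotient-edge (inj₂ tt) (inj₁ a) _ = Qᵘ.E-quotient b (inj₂ tt) (inj₁ a)
    quotient-edge (inj₂ tt) (inj₂ tt) t≢t = ⊥-elim (t≢t refl)

  M-iso : substG quotient M′ ≅ substG G M
  M-iso = Q.subst-quotient M

  N-iso : substG (compl quotient) N′ ≅ substG (compl G) N
  N-iso = ≅-trans (subst-reindex Qᶜ.quotient (compl quotient) id id (λ _ → refl) (λ _ → refl)
                                 compl-quotient-edges N′)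
          (≅-trans (subst-cong Qᶜ.quotient λ { (inj₁ _) → ≅-refl ; (inj₂ tt) → compl-induce G S N-inside })
                   (Qᶜ.subst-quotient N))

  -- MN true and MN false are the families of ⨂ and ⨆ in PrimeRules.
  MN : Bool → V G → Graph
  MN b v = joinG (M v) (N v) (const (not b))

  MN′ : Bool → V quotient → Graph
  MN′ b x = joinG (M′ x) (N′ x) (const (not b))

  split : ∀ b → substG (uniform b G) (MN b)
                ≅ plug (substG (Qᵘ.outside b) (MN b ∘ proj₁)) (const b)
                       (substG (uniform b inside) (MN b ∘ proj₁))
  split b = ≅-sym (Qᵘ.subst-partition b (MN b))

  merge : ∀ b → plug (substG (Qᵘ.outside b) (MN b ∘ proj₁)) (const b) (MN′ b (inj₂ tt))
                ≅ substG (uniform b quotient) (MN′ b)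
  merge b =
    ≅-trans (≅-sym (Qᵘ.subst-quotient-plug b (MN b) (MN′ b (inj₂ tt))))
    (≅-trans (subst-cong (Qᵘ.quotient b) {[ MN b ∘ proj₁ , const (MN′ b (inj₂ tt)) ]} {MN′ b}
                         λ { (inj₁ _) → ≅-refl ; (inj₂ tt) → ≅-refl })
             (subst-reindex (uniform b quotient) (Qᵘ.quotient b) id id (λ _ → refl) (λ _ → refl)
                            (uniform-quotient-edges b) _))

  prime-rules-module : PrimeRules inside M-inside N-inside → PrimeRules quotient M′ N′ → PrimeRules G M N
  prime-rules-module (inside↓ , inside↑) (quotient↓ , quotient↑) =
    iso-derivation (split true)
    ◅◅ plug-derivation _ _ inside↓
    ◅◅ iso-derivation (merge true)
    ◅◅ quotient↓
    ◅◅ iso-derivation (join-cong M-iso N-iso (λ _ → refl))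
    , iso-derivation (≅-sym (join-cong M-iso N-iso (λ _ → refl)))
    ◅◅ quotient↑
    ◅◅ iso-derivation (≅-sym (merge false))
    ◅◅ plug-derivation _ _ inside↑
    ◅◅ iso-derivation (≅-sym (split false))

  quotient-length : length (elems quotient) ≡ suc (length (elems Q.outside))
  quotient-length = begin
    length (map inj₁ xs ++ map inj₂ (tt ∷ [])) ≡⟨ length-++ (map inj₁ xs) ⟩
    length (map inj₁ xs) + 1                   ≡⟨ cong (_+ 1) (length-map inj₁ xs) ⟩
    length xs + 1                              ≡⟨ +-comm _ 1 ⟩
    suc (length xs)                            ∎
    where
    open ≡-Reasoning
    xs = elems Q.outside

module _ (G : Graph) (M N : V G → Graph) (module-free : ¬ HasNontrivialModule G)
         (M-nonempty : ∀ v → V (M v)) where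

  prime-rules-module-free : (xs : List (V G)) → Unique xs → (∀ v → v ∈ xs) → PrimeRules G M N
  prime-rules-module-free [] _ covered = prime-rules-empty G M N (λ v → case covered v of λ ())
  prime-rules-module-free (a ∷ []) _ covered =
    prime-rules-one G M N a λ v → case covered v of λ { (here v≡a) → v≡a }
  prime-rules-module-free (a ∷ b ∷ []) ((a≢b ∷ []) ∷ _) covered =
    prime-rules-two G M N a b a≢b λ v → case covered v of λ
      { (here v≡a) → inj₁ v≡a ; (there (here v≡b)) → inj₂ v≡b }
  prime-rules-module-free (a ∷ b ∷ c ∷ []) ((a≢b ∷ a≢c ∷ []) ∷ (b≢c ∷ []) ∷ _) covered =
    ⊥-elim (module-free (three-vertices-module G a≢b a≢c b≢c λ v → case covered v of λ
      { (here v≡a) → inj₁ v≡a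
      ; (there (here v≡b)) → inj₂ (inj₁ v≡b)
      ; (there (there (here v≡c))) → inj₂ (inj₂ v≡c) }))
  prime-rules-module-free xs@(_ ∷ _ ∷ _ ∷ _ ∷ _) xs-unique _ =
    prime-rules-prime G M N (prime G module-free at-least-2)
                            (prime (compl G) (compl-module-free G module-free) at-least-2)
                            at-least-4 M-nonempty
    where
    at-least-4 : AtLeast 4 G
    at-least-4 = atLeast-weaken G (s≤s (s≤s (s≤s (s≤s z≤n)))) (unique-atLeast G xs xs-unique)
    at-least-2 : AtLeast 2 G
    at-least-2 = atLeast-weaken G (s≤s (s≤s z≤n)) at-least-4

prime-rules-nonempty : ∀ n (G : Graph) → length (elems G) ≤ n → (M N : V G → Graph) → (∀ v → V (M v)) →
                       PrimeRules G M N
prime-rules-nonempty zero G size M N _ =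
  prime-rules-empty G M N λ v → no-elements (elems G) size (complete G v)
  where
  no-elements : ∀ {A : Set} (xs : List A) → length xs ≤ 0 → ∀ {v} → ¬ v ∈ xs
  no-elements [] _ ()
prime-rules-nonempty (suc n) G size M N M-nonempty with nontrivial-module? G
... | yes (S , S-module , u , w , z , Su , Sw , u≢w , Sz) =
  prime-rules-module (prime-rules-nonempty n inside inside-size M-inside N-inside (M-nonempty ∘ proj₁))
                     (prime-rules-nonempty n quotient quotient-size M′ N′ M′-nonempty)
  where
  open ModuleCase G M N S S-module u Su
  inside-size : length (elems inside) ≤ n
  inside-size =
    ≤-pred (≤-trans (restrict-length-< S (complete G z) (T-not⁻ (Equivalence.from T-not-≡ Sz))) size)
  quotient-size : length (elems quotient) ≤ n
  quotient-size rewrite quotient-length =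
    ≤-pred (≤-trans (restrict-length-<₂ (not ∘ S) (complete G u) (complete G w) u≢w (in-S Su) (in-S Sw)) size)
    where
    in-S : ∀ {v} → S v ≡ true → ¬ T (not (S v))
    in-S Sv ¬Sv = T-not⁻ ¬Sv (Equivalence.from T-≡ Sv)
  M′-nonempty : ∀ x → V (M′ x)
  M′-nonempty (inj₁ (v , _)) = M-nonempty v
  M′-nonempty (inj₂ tt) = (u , Equivalence.from T-≡ Su) , M-nonempty u
... | no module-free =
  prime-rules-module-free G M N module-free M-nonempty (deduplicate (_≟V_ G) (elems G))
                          (deduplicate-! (_≟V_ G) (elems G)) (λ v → ∈-deduplicate⁺ (_≟V_ G) (complete G v))

prime-rules-induce : (G : Graph) (M N : V G → Graph) (P : V G → Bool) →
  (∀ v → ¬ T (P v) → IsEmptyG (M v) × IsEmptyG (N v)) →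
  PrimeRules (induce G P) (M ∘ proj₁) (N ∘ proj₁) → PrimeRules G M N
prime-rules-induce G M N P empty-outside (induced↓ , induced↑) =
  iso-derivation (≅-sym (subst-induce (uniform true G) P _ (both-empty false)))
  ◅◅ induced↓
  ◅◅ iso-derivation (restriction false)
  , iso-derivation (≅-sym (restriction true))
  ◅◅ induced↑
  ◅◅ iso-derivation (subst-induce (uniform false G) P _ (both-empty true))
  where
  both-empty : (b : Bool) → ∀ v → ¬ T (P v) → IsEmptyG (joinG (M v) (N v) (const b))
  both-empty b v ¬Pv (inj₁ x) = proj₁ (empty-outside v ¬Pv) x
  both-empty b v ¬Pv (inj₂ y) = proj₂ (empty-outside v ¬Pv) y
  restriction : ∀ b →
    joinG (substG (induce G P) (M ∘ proj₁)) (substG (compl (induce G P)) (N ∘ proj₁)) (const b)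
    ≅ joinG (substG G M) (substG (compl G) N) (const b)
  restriction b = join-cong (subst-induce G P M (λ v → proj₁ ∘ empty-outside v))
    (≅-trans (compl-induce G P (N ∘ proj₁)) (subst-induce (compl G) P N (λ v → proj₂ ∘ empty-outside v)))
    (λ _ → refl)

lemma5p1 : (G : Graph) (M N : V G → Graph) →
    (∀ v → IsEmptyG (M v) → IsEmptyG (N v)) →
    Derivation SGS↓ (⨂ G (λ v → M v ⊔G N v)) (substG G M ⊔G substG (compl G) N)
    × Derivation SGS↑ (substG G M ⊗G substG (compl G) N) (⨆ G (λ v → M v ⊗G N v))
lemma5p1 G M N M-empty⇒N-empty =
  prime-rules-induce G M N P (λ v ¬Pv → M-empty v ¬Pv , M-empty⇒N-empty v (M-empty v ¬Pv))
    (prime-rules-nonempty _ (induce G P) ≤-refl (M ∘ proj₁) (N ∘ proj₁) (toWitness ∘ proj₂))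
  where
  P : V G → Bool
  P v = ⌊ nonempty? (M v) ⌋
  M-empty : ∀ v → ¬ T (P v) → IsEmptyG (M v)
  M-empty v ¬Pv x = ¬Pv (fromWitness x)
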